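{- Let $\mathcal{M}$ be a model of $\mathsf{HA}$ with $\neg(\mathcal{M}\cong\mathbb{N})$, and let $\varphi(x)$ be a unary formula with $\mathcal{M}\vDash\varphi(\overline{n})$ for every $n:\mathbb{N}$. Then: (1) $\neg\big(\forall e:\mathcal{M}.\ \mathcal{M}\vDash\varphi(e)\to\mathsf{std}(e)\big)$; (2) if $\mathsf{std}$ is stable, then $\neg\neg\,\exists e:\mathcal{M}.\ \neg\mathsf{std}(e)\land\mathcal{M}\vDash\varphi(e)$; (3) if $\mathsf{DNE}$ holds, then $\exists e:\mathcal{M}.\ \neg\mathsf{std}(e)\land\mathcal{M}\vDash\varphi(e)$.
   Context: Meta-theory: constructive type theory (Calculus of Inductive Constructions), no classical axioms assumed unless stated. $\mathsf{DNE}$: for every proposition $P$, $\neg\neg P\to P$. A predicate $p$ is stable if $\neg\neg p\,x\to p\,x$ for all $x$. Arithmetic signature $0,S,+,\times,=$; $\mathsf{HA}$ is Heyting arithmetic (axioms for successor disjointness/injectivity, recursion equations for $+$ and $\times$, equality axioms, and the induction scheme for all formulas, with intuitionistic deduction). A model $\mathcal{M}$ of $\mathsf{HA}$ is a type with interpretations of $0,S,+,\times$, with $=$ interpreted as actual equality, satisfying the $\mathsf{HA}$ axioms under Tarski semantics. $\mathcal{M}\vDash\varphi(e)$ means $\varphi$ holds with its free variable assigned $e$. $\overline{n}$ denotes $(S^{\mathcal{M}})^n(0^{\mathcal{M}})$; $\mathsf{std}(e):=\exists n:\mathbb{N}.\ \overline{n}=e$. $\mathcal{M}\cong\mathbb{N}$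 means there is a bijective homomorphism $\mathbb{N}\to\mathcal{M}$. -}

module Defs where

import Data.Nat
open import Data.Nat using (ℕ; zero; suc; _≤_; _<_)
open import Data.Empty using (⊥)
open import Data.Product using (Σ; _×_; _,_)
open import Data.Sum using (_⊎_)
open import Relation.Nullary using (¬_)
open import Relation.Binary.PropositionalEquality using (_≡_)
open import Function using (_∘_)

infixl 7 _⊗_
infixl 6 _⊕_
infix  4 _≐_
infixr 3 _∧̇_
infixr 2 _∨̇_
infixr 1 _⇒_

data Tm : Set where
  var  : ℕ → Tm
  zer  : Tm
  suċ  : Tm → Tm
  _⊕_  : Tm → Tm → Tm
  _⊗_  : Tm → Tm → Tm

data Fm : Set where
  ⊥̇    : Fm
  _≐_  : Tm → Tm → Fm
  _∧̇_  : Fm → Fm → Fm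
  _∨̇_  : Fm → Fm → Fm
  _⇒_  : Fm → Fm → Fm
  ∀̇    : Fm → Fm
  ∃̇    : Fm → Fm

¬̇_ : Fm → Fm
¬̇ φ = φ ⇒ ⊥̇

renT : (ℕ → ℕ) → Tm → Tm
renT r (var k)  = var (r k)
renT r zer      = zer
renT r (suċ t)  = suċ (renT r t)
renT r (s ⊕ t)  = renT r s ⊕ renT r t
renT r (s ⊗ t)  = renT r s ⊗ renT r t

substT : (ℕ → Tm) → Tm → Tm
substT σ (var k)  = σ k
substT σ zer      = zer
substT σ (suċ t)  = suċ (substT σ t)
substT σ (s ⊕ t)  = substT σ s ⊕ substT σ t
substT σ (s ⊗ t)  = substT σ s ⊗ substT σ t

up : (ℕ → Tm) → (ℕ → Tm)
up σ zero    = var zero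
up σ (suc k) = renT suc (σ k)

subst : (ℕ → Tm) → Fm → Fm
subst σ ⊥̇        = ⊥̇
subst σ (s ≐ t)  = substT σ s ≐ substT σ t
subst σ (φ ∧̇ ψ)  = subst σ φ ∧̇ subst σ ψ
subst σ (φ ∨̇ ψ)  = subst σ φ ∨̇ subst σ ψ
subst σ (φ ⇒ ψ)  = subst σ φ ⇒ subst σ ψ
subst σ (∀̇ φ)    = ∀̇ (subst (up σ) φ)
subst σ (∃̇ φ)    = ∃̇ (subst (up σ) φ)

data BoundedT (n : ℕ) : Tm → Set where
  bvar : ∀ {k} → k < n → BoundedT n (var k)
  bzer : BoundedT n zer
  bsuc : ∀ {t} → BoundedT n t → BoundedT n (suċ t)
  badd : ∀ {s t} → BoundedT n s → BoundedT n t → BoundedT n (s ⊕ t)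
  bmul : ∀ {s t} → BoundedT n s → BoundedT n t → BoundedT n (s ⊗ t)

data Bounded : ℕ → Fm → Set where
  b⊥   : ∀ {n} → Bounded n ⊥̇
  b≐   : ∀ {n s t} → BoundedT n s → BoundedT n t → Bounded n (s ≐ t)
  b∧   : ∀ {n φ ψ} → Bounded n φ → Bounded n ψ → Bounded n (φ ∧̇ ψ)
  b∨   : ∀ {n φ ψ} → Bounded n φ → Bounded n ψ → Bounded n (φ ∨̇ ψ)
  b⇒   : ∀ {n φ ψ} → Bounded n φ → Bounded n ψ → Bounded n (φ ⇒ ψ)
  b∀   : ∀ {n φ} → Bounded (suc n) φ → Bounded n (∀̇ φ)
  b∃   : ∀ {n φ} → Bounded (suc n) φ → Bounded n (∃̇ φ)

Unary : Fm → Set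
Unary = Bounded 1

v0 v1 v2 : Tm
v0 = var 0
v1 = var 1
v2 = var 2

-- induction instance for φ (var 0 is the induction variable,
-- var (suc k) are parameters, universally quantified by the semantics)
indAx : Fm → Fm
indAx φ =
  subst σ₀ φ ⇒ ∀̇ (φ ⇒ subst σS φ) ⇒ ∀̇ φ
  where
  σ₀ : ℕ → Tm
  σ₀ zero    = zer
  σ₀ (suc k) = var k
  σS : ℕ → Tm
  σS zero    = suċ (var zero)
  σS (suc k) = var (suc k)

data HA : Fm → Set where
  ax-refl  : HA (∀̇ (v0 ≐ v0))
  ax-sym   : HA (∀̇ (∀̇ (v1 ≐ v0 ⇒ v0 ≐ v1)))
  ax-trans : HA (∀̇ (∀̇ (∀̇ (v2 ≐ v1 ⇒ v1 ≐ v0 ⇒ v2 ≐ v0))))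
  ax-congS : HA (∀̇ (∀̇ (v1 ≐ v0 ⇒ suċ v1 ≐ suċ v0)))
  ax-cong+ : HA (∀̇ (∀̇ (∀̇ (∀̇ (var 3 ≐ v2 ⇒ v1 ≐ v0 ⇒ var 3 ⊕ v1 ≐ v2 ⊕ v0)))))
  ax-cong× : HA (∀̇ (∀̇ (∀̇ (∀̇ (var 3 ≐ v2 ⇒ v1 ≐ v0 ⇒ var 3 ⊗ v1 ≐ v2 ⊗ v0)))))
  ax-zero-succ : HA (∀̇ (¬̇ (zer ≐ suċ v0)))
  ax-succ-inj  : HA (∀̇ (∀̇ (suċ v1 ≐ suċ v0 ⇒ v1 ≐ v0)))
  ax-add-zero : HA (∀̇ (zer ⊕ v0 ≐ v0))
  ax-add-rec  : HA (∀̇ (∀̇ (suċ v0 ⊕ v1 ≐ suċ (v0 ⊕ v1))))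
  ax-mult-zero : HA (∀̇ (zer ⊗ v0 ≐ zer))
  ax-mult-rec  : HA (∀̇ (∀̇ (suċ v0 ⊗ v1 ≐ v1 ⊕ v0 ⊗ v1)))
  ax-ind : ∀ φ → HA (indAx φ)

record Structure : Set₁ where
  field
    D    : Set
    o    : D
    s    : D → D
    plus : D → D → D
    mult : D → D → D

module _ (𝔐 : Structure) where
  open Structure 𝔐

  evalT : (ℕ → D) → Tm → D
  evalT ρ (var k) = ρ k
  evalT ρ zer     = o
  evalT ρ (suċ t) = s (evalT ρ t)
  evalT ρ (a ⊕ b) = plus (evalT ρ a) (evalT ρ b)
  evalT ρ (a ⊗ b) = mult (evalT ρ a) (evalT ρ b)

  _∷ₑ_ : D → (ℕ → D) → (ℕ → D)
  (d ∷ₑ ρ) zero    = d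
  (d ∷ₑ ρ) (suc k) = ρ k

  sat : (ℕ → D) → Fm → Set
  sat ρ ⊥̇       = ⊥
  sat ρ (a ≐ b) = evalT ρ a ≡ evalT ρ b
  sat ρ (φ ∧̇ ψ) = sat ρ φ × sat ρ ψ
  sat ρ (φ ∨̇ ψ) = sat ρ φ ⊎ sat ρ ψ
  sat ρ (φ ⇒ ψ) = sat ρ φ → sat ρ ψ
  sat ρ (∀̇ φ)   = (d : D) → sat (d ∷ₑ ρ) φ
  sat ρ (∃̇ φ)   = Σ D (λ d → sat (d ∷ₑ ρ) φ)

record Model : Set₁ where
  field
    𝔐      : Structure
    sound  : ∀ φ → HA φ → (ρ : ℕ → Structure.D 𝔐) → sat 𝔐 ρ φ
  open Structure 𝔐 public

module _ (M : Model) where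
  open Model M

  _⊨_[_] : Fm → D → Set
  _⊨_[_] φ e = sat 𝔐 (λ _ → e) φ

  num : ℕ → D
  num zero    = o
  num (suc n) = s (num n)

  std : D → Set
  std e = Σ ℕ (λ n → num n ≡ e)

  IsHom : (ℕ → D) → Set
  IsHom h = (h 0 ≡ o)
          × (∀ n → h (suc n) ≡ s (h n))
          × (∀ m n → h (m Data.Nat.+ n) ≡ plus (h m) (h n))
          × (∀ m n → h (m Data.Nat.* n) ≡ mult (h m) (h n))

  IsBij : (ℕ → D) → Set
  IsBij h = (∀ m n → h m ≡ h n → m ≡ n) × (∀ e → Σ ℕ (λ n → h n ≡ e))

  Iso-ℕ : Set
  Iso-ℕ = Σ (ℕ → D) (λ h → IsHom h × IsBij h)



DNE : Set₁
DNE = (P : Set) → ¬ ¬ P → P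

Stable : {A : Set} → (A → Set) → Set
Stable {A} p = (x : A) → ¬ ¬ p x → p x

module Submission where

-- If every element satisfying φ were standard, φ would be closed under
-- successor (φ d forces d = n̄, and φ holds at the numeral n+1), so the
-- induction axiom for φ makes φ, and hence standardness, hold everywhere;
-- the numeral map ℕ → M is then an isomorphism. Parts (2) and (3) are the
-- stable and classical readings of (1).

open import Defs
open import Data.Nat using (ℕ; zero; suc; _+_; _*_; _<_; s≤s)
open import Data.Product using (Σ; _×_; _,_)
open import Data.Product.Function.Dependent.Propositional using (Σ-⇔)
open import Data.Product.Function.NonDependent.Propositional using (_×-⇔_)
open import Data.Sum.Function.Propositional using (_⊎-⇔_)
open import Data.Empty using (⊥-elim)
open import Function.Bundles using (_⇔_; mk⇔; Equivalence)
open import Function.Construct.Identity using (⇔-id; ↠-id)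
open import Function.Related.TypeIsomorphisms using (→-cong-⇔)
open import Relation.Nullary using (¬_)
open import Relation.Binary.PropositionalEquality
  using (_≡_; refl; sym; trans; cong; cong₂; module ≡-Reasoning)

open Equivalence using (to; from)

module Semantics (𝔐 : Structure) where
  open Structure 𝔐

  Env : Set
  Env = ℕ → D

  eval : Env → Tm → D
  eval = evalT 𝔐

  holds : Env → Fm → Set
  holds = sat 𝔐

  _∷_ : D → Env → Env
  _∷_ = _∷ₑ_ 𝔐

  Π-⇔ : {A B : D → Set} → (∀ d → A d ⇔ B d) → ((d : D) → A d) ⇔ ((d : D) → B d)
  Π-⇔ A⇔B = mk⇔ (λ f d → to (A⇔B d) (f d)) (λ g d → from (A⇔B d) (g d))

  ≡-⇔ : {a a′ b b′ : D} → a ≡ a′ → b ≡ b′ → (a ≡ b) ⇔ (a′ ≡ b′)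
  ≡-⇔ refl refl = ⇔-id _

  eval-renT-suc : ∀ d ρ t → eval (d ∷ ρ) (renT suc t) ≡ eval ρ t
  eval-renT-suc d ρ (var k) = refl
  eval-renT-suc d ρ zer     = refl
  eval-renT-suc d ρ (suċ t) = cong s (eval-renT-suc d ρ t)
  eval-renT-suc d ρ (a ⊕ b) = cong₂ plus (eval-renT-suc d ρ a) (eval-renT-suc d ρ b)
  eval-renT-suc d ρ (a ⊗ b) = cong₂ mult (eval-renT-suc d ρ a) (eval-renT-suc d ρ b)

  eval-substT : ∀ {σ ρ τ} → (∀ k → eval ρ (σ k) ≡ τ k) → ∀ t → eval ρ (substT σ t) ≡ eval τ t
  eval-substT σ≈τ (var k) = σ≈τ k
  eval-substT σ≈τ zer     = refl
  eval-substT σ≈τ (suċ t) = cong s (eval-substT σ≈τ t)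
  eval-substT σ≈τ (a ⊕ b) = cong₂ plus (eval-substT σ≈τ a) (eval-substT σ≈τ b)
  eval-substT σ≈τ (a ⊗ b) = cong₂ mult (eval-substT σ≈τ a) (eval-substT σ≈τ b)

  eval-up : ∀ {σ ρ τ} → (∀ k → eval ρ (σ k) ≡ τ k) → ∀ d k → eval (d ∷ ρ) (up σ k) ≡ (d ∷ τ) k
  eval-up         σ≈τ d zero    = refl
  eval-up {σ} {ρ} σ≈τ d (suc k) = trans (eval-renT-suc d ρ (σ k)) (σ≈τ k)

  sat-subst : ∀ φ {σ ρ τ} → (∀ k → eval ρ (σ k) ≡ τ k) → holds ρ (subst σ φ) ⇔ holds τ φ
  sat-subst ⊥̇       σ≈τ = ⇔-id _
  sat-subst (a ≐ b) σ≈τ = ≡-⇔ (eval-substT σ≈τ a) (eval-substT σ≈τ b)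
  sat-subst (φ ∧̇ ψ) σ≈τ = sat-subst φ σ≈τ ×-⇔ sat-subst ψ σ≈τ
  sat-subst (φ ∨̇ ψ) σ≈τ = sat-subst φ σ≈τ ⊎-⇔ sat-subst ψ σ≈τ
  sat-subst (φ ⇒ ψ) σ≈τ = →-cong-⇔ (sat-subst φ σ≈τ) (sat-subst ψ σ≈τ)
  sat-subst (∀̇ φ)   σ≈τ = Π-⇔ λ d → sat-subst φ (eval-up σ≈τ d)
  sat-subst (∃̇ φ)   σ≈τ = Σ-⇔ (↠-id _) (sat-subst φ (eval-up σ≈τ _))

  _≈[_]_ : Env → ℕ → Env → Set
  ρ ≈[ n ] τ = ∀ k → k < n → ρ k ≡ τ k

  ∷-≈ : ∀ {n ρ τ} d → ρ ≈[ n ] τ → (d ∷ ρ) ≈[ suc n ] (d ∷ τ)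
  ∷-≈ d ρ≈τ zero    _       = refl
  ∷-≈ d ρ≈τ (suc k) (s≤s p) = ρ≈τ k p

  eval-bounded : ∀ {n t ρ τ} → BoundedT n t → ρ ≈[ n ] τ → eval ρ t ≡ eval τ t
  eval-bounded (bvar p)   ρ≈τ = ρ≈τ _ p
  eval-bounded bzer       ρ≈τ = refl
  eval-bounded (bsuc b)   ρ≈τ = cong s (eval-bounded b ρ≈τ)
  eval-bounded (badd a b) ρ≈τ = cong₂ plus (eval-bounded a ρ≈τ) (eval-bounded b ρ≈τ)
  eval-bounded (bmul a b) ρ≈τ = cong₂ mult (eval-bounded a ρ≈τ) (eval-bounded b ρ≈τ)

  sat-bounded : ∀ {n φ ρ τ} → Bounded n φ → ρ ≈[ n ] τ → holds ρ φ ⇔ holds τ φ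
  sat-bounded b⊥       ρ≈τ = ⇔-id _
  sat-bounded (b≐ a b) ρ≈τ = ≡-⇔ (eval-bounded a ρ≈τ) (eval-bounded b ρ≈τ)
  sat-bounded (b∧ φ ψ) ρ≈τ = sat-bounded φ ρ≈τ ×-⇔ sat-bounded ψ ρ≈τ
  sat-bounded (b∨ φ ψ) ρ≈τ = sat-bounded φ ρ≈τ ⊎-⇔ sat-bounded ψ ρ≈τ
  sat-bounded (b⇒ φ ψ) ρ≈τ = →-cong-⇔ (sat-bounded φ ρ≈τ) (sat-bounded ψ ρ≈τ)
  sat-bounded (b∀ φ)   ρ≈τ = Π-⇔ λ d → sat-bounded φ (∷-≈ d ρ≈τ)
  sat-bounded (b∃ φ)   ρ≈τ = Σ-⇔ (↠-id _) (sat-bounded φ (∷-≈ _ ρ≈τ))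

  sat-unary : ∀ {φ} d ρ → Unary φ → holds (d ∷ ρ) φ ⇔ holds (λ _ → d) φ
  sat-unary d ρ u = sat-bounded u λ { zero _ → refl ; (suc k) (s≤s ()) }

  sat-indAx : ∀ φ {ρ} → holds ρ (indAx φ)
            → holds (o ∷ ρ) φ → (∀ d → holds (d ∷ ρ) φ → holds (s d ∷ ρ) φ)
            → ∀ d → holds (d ∷ ρ) φ
  sat-indAx φ ind base step = ind
    (from (sat-subst φ λ { zero → refl ; (suc k) → refl }) base)
    (λ d φd → from (sat-subst φ λ { zero → refl ; (suc k) → refl }) (step d φd))

module Arithmetic (M : Model) where
  open Model M
  open Semantics 𝔐

  private
    ρ₀ : Env
    ρ₀ _ = o

  plus-zeroˡ : ∀ e → plus o e ≡ e
  plus-zeroˡ e = sound _ ax-add-zero ρ₀ e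

  plus-sucˡ : ∀ d e → plus (s d) e ≡ s (plus d e)
  plus-sucˡ d e = sound _ ax-add-rec ρ₀ e d

  mult-zeroˡ : ∀ e → mult o e ≡ o
  mult-zeroˡ e = sound _ ax-mult-zero ρ₀ e

  mult-sucˡ : ∀ d e → mult (s d) e ≡ plus e (mult d e)
  mult-sucˡ d e = sound _ ax-mult-rec ρ₀ e d

  o≢s : ∀ d → ¬ o ≡ s d
  o≢s d = sound _ ax-zero-succ ρ₀ d

  s-injective : ∀ {d e} → s d ≡ s e → d ≡ e
  s-injective {d} {e} = sound _ ax-succ-inj ρ₀ d e

  induction : ∀ {φ} → Unary φ → M ⊨ φ [ o ] → (∀ d → M ⊨ φ [ d ] → M ⊨ φ [ s d ])
            → ∀ e → M ⊨ φ [ e ]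
  induction {φ} u base step e = to (unary e) (sat-indAx φ (sound _ (ax-ind φ) ρ₀)
    (from (unary o) base)
    (λ d φd → from (unary (s d)) (step d (to (unary d) φd)))
    e)
    where
    unary : ∀ d → holds (d ∷ ρ₀) φ ⇔ M ⊨ φ [ d ]
    unary d = sat-unary d ρ₀ u

  num-+-homo : ∀ m n → num M (m + n) ≡ plus (num M m) (num M n)
  num-+-homo zero    n = sym (plus-zeroˡ _)
  num-+-homo (suc m) n = trans (cong s (num-+-homo m n)) (sym (plus-sucˡ _ _))

  num-*-homo : ∀ m n → num M (m * n) ≡ mult (num M m) (num M n)
  num-*-homo zero    n = sym (mult-zeroˡ _)
  num-*-homo (suc m) n = begin
    num M (n + m * n)                         ≡⟨ num-+-homo n (m * n) ⟩
    plus (num M n) (num M (m * n))            ≡⟨ cong (plus (num M n)) (num-*-homo m n) ⟩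
    plus (num M n) (mult (num M m) (num M n)) ≡⟨ sym (mult-sucˡ _ _) ⟩
    mult (s (num M m)) (num M n)              ∎
    where open ≡-Reasoning

  num-injective : ∀ m n → num M m ≡ num M n → m ≡ n
  num-injective zero    zero    p = refl
  num-injective zero    (suc n) p = ⊥-elim (o≢s _ p)
  num-injective (suc m) zero    p = ⊥-elim (o≢s _ (sym p))
  num-injective (suc m) (suc n) p = cong suc (num-injective m n (s-injective p))

  num-isHom : IsHom M (num M)
  num-isHom = refl , (λ _ → refl) , num-+-homo , num-*-homo

  all-std⇒Iso-ℕ : (∀ e → std M e) → Iso-ℕ M
  all-std⇒Iso-ℕ all-std = num M , num-isHom , num-injective , all-std

  numerals⊆φ⊆std⇒universal : ∀ {φ} → Unary φ → (∀ n → M ⊨ φ [ num M n ])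
                            → (∀ e → M ⊨ φ [ e ] → std M e) → ∀ e → M ⊨ φ [ e ]
  numerals⊆φ⊆std⇒universal {φ} u φ-num φ⊆std = induction u (φ-num 0) step
    where
    step : ∀ d → M ⊨ φ [ d ] → M ⊨ φ [ s d ]
    step d φd with φ⊆std d φd
    ... | n , refl = φ-num (suc n)

lemma4p8 : (M : Model) → ¬ Iso-ℕ M → (φ : Fm) → Unary φ
    → ((n : ℕ) → _⊨_[_] M φ (num M n))
    → (¬ ((e : Model.D M) → _⊨_[_] M φ e → std M e))
      × (Stable (std M) → ¬ ¬ Σ (Model.D M) (λ e → ¬ std M e × _⊨_[_] M φ e))
      × (DNE → Σ (Model.D M) (λ e → ¬ std M e × _⊨_[_] M φ e))
lemma4p8 M ¬iso φ u φ-num = φ⊈std , ¬¬nonstandard , nonstandard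
  where
  open Arithmetic M

  φ⊈std : ¬ ((e : Model.D M) → M ⊨ φ [ e ] → std M e)
  φ⊈std φ⊆std =
    ¬iso (all-std⇒Iso-ℕ λ e → φ⊆std e (numerals⊆φ⊆std⇒universal u φ-num φ⊆std e))

  ¬¬nonstandard : Stable (std M) → ¬ ¬ Σ (Model.D M) (λ e → ¬ std M e × M ⊨ φ [ e ])
  ¬¬nonstandard stable ∄ = φ⊈std λ e φe → stable e λ ¬std → ∄ (e , ¬std , φe)

  nonstandard : DNE → Σ (Model.D M) (λ e → ¬ std M e × M ⊨ φ [ e ])
  nonstandard dne = dne _ (¬¬nonstandard λ e → dne _)
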